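{- For $j\in\{0,1,2\}$ there is a constant $C$ such that $|d_j(n)|\le C\sqrt{|n|}$ for all $n\in\mathbb Z+\beta_j$.
   Context: $Q(\mathbf n)=12n_1^2-2n_2^2$. Sets: $\mathcal S_0^+=\{(\tfrac7{24},0),(\tfrac{17}{24},0),(\tfrac{11}{24},\tfrac12),(\tfrac{13}{24},\tfrac12)\}$, $\mathcal S_0^-=\{(\tfrac1{24},0),(\tfrac{23}{24},0),(\tfrac5{24},\tfrac12),(\tfrac{19}{24},\tfrac12)\}$, $\mathcal S_1^+=\{(\tfrac{11}{24},0),(\tfrac{13}{24},0),(\tfrac7{24},\tfrac12),(\tfrac{17}{24},\tfrac12)\}$, $\mathcal S_1^-=\{(\tfrac5{24},0),(\tfrac{19}{24},0),(\tfrac1{24},\tfrac12),(\tfrac{23}{24},\tfrac12)\}$, $\mathcal S_2^+=\{(\tfrac5{12},\tfrac14),(\tfrac7{12},\tfrac14),(\tfrac5{12},\tfrac34),(\tfrac7{12},\tfrac34)\}$, $\mathcal S_2^-=\{(\tfrac1{12},\tfrac14),(\tfrac{11}{12},\tfrac14),(\tfrac1{12},\tfrac34),(\tfrac{11}{12},\tfrac34)\}$; $\beta_0=\tfrac1{48},\beta_1=\tfrac{25}{48},\beta_2=\tfrac{23}{24}$. For $\boldsymbol\mu\in\mathcal S_j^\pm$, $n\in\mathbb Z+\beta_j$: $a_{\boldsymbol\mu}(n)=\tfrac12\sum_{\mathbf m\in\mathbb Z^2+\boldsymbol\mu,Q(\mathbf m)=n}(1+\operatorname{sgn}(2m_1+m_2)\operatorname{sgn}(2m_1-m_2))$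 for $n>0$ and $a_{\boldsymbol\mu}(n)=\tfrac12\sum_{\mathbf m\in\mathbb Z^2+\boldsymbol\mu,Q(\mathbf m)=n}(1-\operatorname{sgn}(3m_1+m_2)\operatorname{sgn}(3m_1-m_2))$ for $n<0$ ($\operatorname{sgn}(0)=0$); $d_j(n)=\tfrac12(\sum_{\mathcal S_j^+}a_{\boldsymbol\mu}(n)-\sum_{\mathcal S_j^- }a_{\boldsymbol\mu}(n))$. -}

module Defs where

open import Data.Bool using (Bool; true; false; if_then_else_)
open import Data.Nat as ℕ using (ℕ)
open import Data.Integer as ℤ using (ℤ; +_)
open import Data.Rational using (ℚ; _/_; _+_; _*_; _-_; -_; 0ℚ; 1ℚ; ½; ↥_)
open import Data.Rational.Properties using (_<?_; _≟_)
open import Data.Fin using (Fin; zero; suc)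
open import Data.List using (List; []; _∷_; map; foldr; concatMap; upTo)
open import Data.Product using (_×_; _,_; proj₁; proj₂)
open import Relation.Nullary.Decidable using (does)

Q : ℚ × ℚ → ℚ
Q (m₁ , m₂) = (+ 12 / 1) * (m₁ * m₁) - (+ 2 / 1) * (m₂ * m₂)

sgn : ℚ → ℚ
sgn x = if does (x <? 0ℚ) then - 1ℚ else (if does (x ≟ 0ℚ) then 0ℚ else 1ℚ)

sumℚ : List ℚ → ℚ
sumℚ = foldr _+_ 0ℚ

weight : ℚ → ℚ × ℚ → ℚ
weight n (m₁ , m₂) =
  if does (0ℚ <? n)
  then ½ * (1ℚ + sgn ((+ 2 / 1) * m₁ + m₂) * sgn ((+ 2 / 1) * m₁ - m₂))
  else (if does (n <? 0ℚ)
        then ½ * (1ℚ - sgn ((+ 3 / 1) * m₁ + m₂) * sgn ((+ 3 / 1) * m₁ - m₂))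
        else 0ℚ)

range : ℕ → List ℤ
range B = map (λ i → + i ℤ.- + B) (upTo (2 ℕ.* B ℕ.+ 1))

-- box bound: every m ∈ ℤ² + μ (μ ∈ [0,1)²) with Q(m) = n and nonzero weight
-- satisfies |mᵢ| ≤ √(3|n|/2), so m − μ lies in [−B, B]² for this B.
bound : ℚ → ℕ
bound n = ℤ.∣ ↥ n ∣ ℕ.+ 2

a : ℚ × ℚ → ℚ → ℚ
a (μ₁ , μ₂) n =
  sumℚ (concatMap (λ k₁ → map (λ k₂ →
          let m = ((k₁ / 1) + μ₁ , (k₂ / 1) + μ₂) in
          if does (Q m ≟ n) then weight n m else 0ℚ)
        (range (bound n))) (range (bound n)))


S⁺ : Fin 3 → List (ℚ × ℚ)
S⁺ zero = (+ 7 / 24 , 0ℚ) ∷ (+ 17 / 24 , 0ℚ) ∷ (+ 11 / 24 , + 1 / 2) ∷ (+ 13 / 24 , + 1 / 2) ∷ []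
S⁺ (suc zero) = (+ 11 / 24 , 0ℚ) ∷ (+ 13 / 24 , 0ℚ) ∷ (+ 7 / 24 , + 1 / 2) ∷ (+ 17 / 24 , + 1 / 2) ∷ []
S⁺ (suc (suc zero)) = (+ 5 / 12 , + 1 / 4) ∷ (+ 7 / 12 , + 1 / 4) ∷ (+ 5 / 12 , + 3 / 4) ∷ (+ 7 / 12 , + 3 / 4) ∷ []

S⁻ : Fin 3 → List (ℚ × ℚ)
S⁻ zero = (+ 1 / 24 , 0ℚ) ∷ (+ 23 / 24 , 0ℚ) ∷ (+ 5 / 24 , + 1 / 2) ∷ (+ 19 / 24 , + 1 / 2) ∷ []
S⁻ (suc zero) = (+ 5 / 24 , 0ℚ) ∷ (+ 19 / 24 , 0ℚ) ∷ (+ 1 / 24 , + 1 / 2) ∷ (+ 23 / 24 , + 1 / 2) ∷ []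
S⁻ (suc (suc zero)) = (+ 1 / 12 , + 1 / 4) ∷ (+ 11 / 12 , + 1 / 4) ∷ (+ 1 / 12 , + 3 / 4) ∷ (+ 11 / 12 , + 3 / 4) ∷ []

β : Fin 3 → ℚ
β zero = + 1 / 48
β (suc zero) = + 25 / 48
β (suc (suc zero)) = + 23 / 24

d : Fin 3 → ℚ → ℚ
d j n = ½ * (sumℚ (map (λ μ → a μ n) (S⁺ j)) - sumℚ (map (λ μ → a μ n) (S⁻ j)))

{-# OPTIONS --safe #-}
module Submission where

-- A lattice point m with Q(m) = n and nonzero weight has m₁² ≤ |n|: the weight vanishes unless
-- (2m₁ + m₂)(2m₁ − m₂) ≥ 0 (for n > 0) resp. (3m₁ + m₂)(3m₁ − m₂) ≤ 0 (for n < 0), and then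
-- Q − m₁² = 3m₁² + 2(2m₁ + m₂)(2m₁ − m₂) resp. −Q − m₁² = 5m₁² − 2(3m₁ + m₂)(3m₁ − m₂) is ≥ 0.
-- For fixed m₁ the equation Q(m) = n fixes m₂², so each column contributes at most 2, and the
-- m₁ of nonzero columns are 1-separated points of [−√|n|, √|n|]; hence a_μ(n) ≤ 2(2√|n| + 1).
-- Then d_j(n), half the difference of two sums of four such nonnegative numbers, is O(√|n|),
-- and |n| ≥ 1/48 on ℤ + β_j absorbs the additive constant.  As ℚ has no square roots, every
-- estimate is carried out on squares.

open import Defs
open import Data.Fin using (Fin)
open import Data.Integer using (ℤ)
open import Data.Product using (Σ)
open import Data.Rational using (ℚ; _/_; _+_; _*_; _≤_; ∣_∣)

open import Algebra.Properties.Group using (inverseˡ-unique; x∙y⁻¹≈ε⇒x≈y)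
open import Data.Bool using (if_then_else_)
open import Data.Empty using (⊥; ⊥-elim)
open import Data.Fin using (zero; suc)
import Data.Integer as ℤ
open import Data.Integer using (+_; -[1+_]; +≤+; -≤-; +<+)
import Data.Integer.Properties as ℤP
open import Data.List using (List; []; _∷_; _++_; map; concat; length)
open import Data.List.Membership.Propositional using (_∈_)
open import Data.List.Properties using (map-∘; map-cong)
open import Data.List.Relation.Unary.All as All using (All; []; _∷_)
open import Data.List.Relation.Unary.AllPairs as AllPairs using (AllPairs; []; _∷_)
import Data.List.Relation.Unary.AllPairs.Properties as AllPairsₚ
open import Data.List.Relation.Unary.Any as Any using (Any; here; there)
open import Data.List.Relation.Unary.Unique.Propositional using (Unique)
open import Data.Nat as ℕ using (ℕ; z≤n)
open import Data.Nat.Coprimality using (1-coprimeTo) renaming (sym to coprime-sym)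
open import Data.Product using (_×_; _,_; proj₁; proj₂; ∃₂)
open import Data.Rational
  using (0ℚ; 1ℚ; ½; -_; _-_; _<_; mkℚ; 1/_; *≤*; ≢-nonZero; positive; negative; nonNegative; nonPositive)
open import Data.Rational.Properties
open import Data.Rational.Solver using (module +-*-Solver)
open import Data.Sum using (_⊎_; inj₁; inj₂)
open import Data.Unit using (tt)
open import Function using (_∘_)
open import Relation.Binary.Definitions using (tri<; tri≈; tri>)
open import Relation.Binary.PropositionalEquality
open import Relation.Nullary using (yes; no; does)
open import Relation.Nullary.Decidable using (dec-true; dec-false)

open +-*-Solver using (solve; _:=_; _:+_; _:*_; _:-_; :-_; con)
open ≤-Reasoning

-- Ordered-field facts

_∈[0,_] : ℚ → ℚ → Set
w ∈[0, c ] = 0ℚ ≤ w × w ≤ c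

p≤p+q : ∀ {p q} → 0ℚ ≤ q → p ≤ p + q
p≤p+q {p} {q} 0≤q = subst (_≤ p + q) (+-identityʳ p) (+-monoʳ-≤ p 0≤q)

p≤q⇒0≤q-p : ∀ {p q} → p ≤ q → 0ℚ ≤ q - p
p≤q⇒0≤q-p {p} {q} p≤q = subst (_≤ q - p) (+-inverseʳ p) (+-monoˡ-≤ (- p) p≤q)

*-mono-≤-nonNeg : ∀ {p q r s} → 0ℚ ≤ p → p ≤ q → 0ℚ ≤ r → r ≤ s → p * r ≤ q * s
*-mono-≤-nonNeg {p} {q} {r} {s} 0≤p p≤q 0≤r r≤s = ≤-trans
  (*-monoʳ-≤-nonNeg r ⦃ nonNegative 0≤r ⦄ p≤q)
  (*-monoˡ-≤-nonNeg q ⦃ nonNegative (≤-trans 0≤p p≤q) ⦄ r≤s)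

*-nonNeg : ∀ {p q} → 0ℚ ≤ p → 0ℚ ≤ q → 0ℚ ≤ p * q
*-nonNeg 0≤p 0≤q = *-mono-≤-nonNeg ≤-refl 0≤p ≤-refl 0≤q

square-nonNeg : ∀ p → 0ℚ ≤ p * p
square-nonNeg p with ≤-total 0ℚ p
... | inj₁ 0≤p = *-nonNeg 0≤p 0≤p
... | inj₂ p≤0 = subst (_≤ p * p) (*-zeroˡ p) (*-monoʳ-≤-nonPos p ⦃ nonPositive p≤0 ⦄ p≤0)

square-mono-≤ : ∀ {p q} → 0ℚ ≤ p → p ≤ q → p * p ≤ q * q
square-mono-≤ 0≤p p≤q = *-mono-≤-nonNeg 0≤p p≤q 0≤p p≤q

square-cancel-≤ : ∀ {p q} → 0ℚ ≤ q → p * p ≤ q * q → p ≤ q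
square-cancel-≤ {p} {q} 0≤q pp≤qq with p ≤? q
... | yes p≤q = p≤q
... | no p≰q = ⊥-elim (<-irrefl refl (<-≤-trans qq<pp pp≤qq))
  where
  q<p : q < p
  q<p = ≰⇒> p≰q
  qq<pp : q * q < p * p
  qq<pp = ≤-<-trans (*-monoˡ-≤-nonNeg q ⦃ nonNegative 0≤q ⦄ (<⇒≤ q<p))
                    (*-monoˡ-<-pos p ⦃ positive (≤-<-trans 0≤q q<p) ⦄ q<p)

difference-square-≤ : ∀ {p q} → 0ℚ ≤ p → 0ℚ ≤ q → (p - q) * (p - q) ≤ p * p + q * q
difference-square-≤ {p} {q} 0≤p 0≤q = begin
  (p - q) * (p - q)
    ≤⟨ p≤p+q (*-nonNeg (nonNegative⁻¹ (+ 2 / 1)) (*-nonNeg 0≤p 0≤q)) ⟩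
  (p - q) * (p - q) + (+ 2 / 1) * (p * q)
    ≡⟨ solve 2 (λ p q → (p :- q) :* (p :- q) :+ con (+ 2 / 1) :* (p :* q) := p :* p :+ q :* q)
             refl p q ⟩
  p * p + q * q
    ∎

p≤∣p∣ : ∀ p → p ≤ ∣ p ∣
p≤∣p∣ p with ≤-total 0ℚ p
... | inj₁ 0≤p = ≤-reflexive (sym (0≤p⇒∣p∣≡p 0≤p))
... | inj₂ p≤0 = ≤-trans p≤0 (0≤∣p∣ p)

-p≤∣p∣ : ∀ p → - p ≤ ∣ p ∣
-p≤∣p∣ p = subst (- p ≤_) (∣-p∣≡∣p∣ p) (p≤∣p∣ (- p))

p≤0⇒∣p∣≡-p : ∀ {p} → p ≤ 0ℚ → ∣ p ∣ ≡ - p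
p≤0⇒∣p∣≡-p {p} p≤0 = trans (sym (∣-p∣≡∣p∣ p)) (0≤p⇒∣p∣≡p (neg-antimono-≤ p≤0))

p*q≡0⇒p≡0 : ∀ {p q} → q ≢ 0ℚ → p * q ≡ 0ℚ → p ≡ 0ℚ
p*q≡0⇒p≡0 {p} {q} q≢0 pq≡0 = begin-equality
  p               ≡⟨ sym (*-identityʳ p) ⟩
  p * 1ℚ          ≡⟨ cong (p *_) (sym (*-inverseʳ q)) ⟩
  p * (q * 1/ q)  ≡⟨ sym (*-assoc p q (1/ q)) ⟩
  p * q * 1/ q    ≡⟨ cong (_* 1/ q) pq≡0 ⟩
  0ℚ * 1/ q       ≡⟨ *-zeroˡ (1/ q) ⟩
  0ℚ              ∎
  where instance _ = ≢-nonZero q≢0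

square-≡⇒≡-neg : ∀ {p q} → p * p ≡ q * q → p ≢ q → q ≡ - p
square-≡⇒≡-neg {p} {q} pp≡qq p≢q = inverseˡ-unique +-0-group q p (p*q≡0⇒p≡0 q-p≢0 product≡0)
  where
  product≡0 : (q + p) * (q - p) ≡ 0ℚ
  product≡0 = begin-equality
    (q + p) * (q - p)  ≡⟨ solve 2 (λ p q → (q :+ p) :* (q :- p) := q :* q :- p :* p) refl p q ⟩
    q * q - p * p      ≡⟨ cong (λ t → q * q - t) pp≡qq ⟩
    q * q - q * q      ≡⟨ +-inverseʳ (q * q) ⟩
    0ℚ                 ∎
  q-p≢0 : q - p ≢ 0ℚ
  q-p≢0 = p≢q ∘ sym ∘ x∙y⁻¹≈ε⇒x≈y +-0-group q p

no-three-distinct-square-roots : ∀ {p q r} → p * p ≡ q * q → p * p ≡ r * r →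
                                 p ≢ q → p ≢ r → q ≢ r → ⊥
no-three-distinct-square-roots pp≡qq pp≡rr p≢q p≢r q≢r =
  q≢r (trans (square-≡⇒≡-neg pp≡qq p≢q) (sym (square-≡⇒≡-neg pp≡rr p≢r)))

-- The integers inside ℚ

private
  /1≡mkℚ : ∀ k → k / 1 ≡ mkℚ k 0 (coprime-sym (1-coprimeTo _))
  /1≡mkℚ (+ n)    = normalize-coprime (coprime-sym (1-coprimeTo n))
  /1≡mkℚ -[1+ n ] = cong -_ (normalize-coprime (coprime-sym (1-coprimeTo (ℕ.suc n))))

/1-+ : ∀ k l → (k ℤ.+ l) / 1 ≡ k / 1 + l / 1
/1-+ k l rewrite /1≡mkℚ k | /1≡mkℚ l =
  cong (_/ 1) (cong₂ ℤ._+_ (sym (ℤP.*-identityʳ k)) (sym (ℤP.*-identityʳ l)))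

/1-mono-≤ : ∀ {k l} → k ℤ.≤ l → k / 1 ≤ l / 1
/1-mono-≤ {k} {l} k≤l rewrite /1≡mkℚ k | /1≡mkℚ l =
  *≤* (subst₂ ℤ._≤_ (sym (ℤP.*-identityʳ k)) (sym (ℤP.*-identityʳ l)) k≤l)

/1-nonNeg : ∀ n → 0ℚ ≤ + n / 1
/1-nonNeg n = /1-mono-≤ {+ 0} {+ n} (+≤+ z≤n)

/1-<⇒+1≤ : ∀ {k l} → k ℤ.< l → k / 1 + 1ℚ ≤ l / 1
/1-<⇒+1≤ {k} {l} k<l = begin
  k / 1 + 1ℚ       ≡⟨ +-comm (k / 1) 1ℚ ⟩
  1ℚ + k / 1       ≡⟨ sym (/1-+ (+ 1) k) ⟩
  (+ 1 ℤ.+ k) / 1  ≤⟨ /1-mono-≤ (ℤP.i<j⇒suc[i]≤j k<l) ⟩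
  l / 1            ∎

-- Sums over lists

sumℚ-++ : ∀ xs ys → sumℚ (xs ++ ys) ≡ sumℚ xs + sumℚ ys
sumℚ-++ []       ys = sym (+-identityˡ (sumℚ ys))
sumℚ-++ (x ∷ xs) ys = trans (cong (_+_ x) (sumℚ-++ xs ys)) (sym (+-assoc x (sumℚ xs) (sumℚ ys)))

sumℚ-concat : ∀ xss → sumℚ (concat xss) ≡ sumℚ (map sumℚ xss)
sumℚ-concat []         = refl
sumℚ-concat (xs ∷ xss) = trans (sumℚ-++ xs (concat xss)) (cong (_+_ (sumℚ xs)) (sumℚ-concat xss))

module _ {A : Set} {f : A → ℚ} where

  sumℚ-nonNeg : (∀ y → 0ℚ ≤ f y) → ∀ L → 0ℚ ≤ sumℚ (map f L)
  sumℚ-nonNeg f≥0 []      = ≤-refl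
  sumℚ-nonNeg f≥0 (y ∷ L) = +-mono-≤ (f≥0 y) (sumℚ-nonNeg f≥0 L)

  sumℚ-≢0⇒Any : ∀ L → sumℚ (map f L) ≢ 0ℚ → Any (λ y → f y ≢ 0ℚ) L
  sumℚ-≢0⇒Any []      S≢0 = ⊥-elim (S≢0 refl)
  sumℚ-≢0⇒Any (y ∷ L) S≢0 with f y ≟ 0ℚ
  ... | no fy≢0  = here fy≢0
  ... | yes fy≡0 = there (sumℚ-≢0⇒Any L (λ S≡0 → S≢0 (cong₂ _+_ fy≡0 S≡0)))

  sumℚ-≤-head : ∀ y L {c} → f y ≡ 0ℚ → sumℚ (map f L) ≤ c → sumℚ (map f (y ∷ L)) ≤ c
  sumℚ-≤-head y L {c} fy≡0 S≤c = begin
    f y + sumℚ (map f L)  ≡⟨ cong (_+ sumℚ (map f L)) fy≡0 ⟩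
    0ℚ + sumℚ (map f L)   ≡⟨ +-identityˡ (sumℚ (map f L)) ⟩
    sumℚ (map f L)        ≤⟨ S≤c ⟩
    c                     ∎

module _ {A : Set} {f : A → ℚ} (f-bounded : ∀ y → f y ∈[0, 1ℚ ]) where

  sumℚ-≤-1 : {P : A → Set} → (∀ {q r} → P q → P r → q ≢ r → f q ≢ 0ℚ → f r ≢ 0ℚ → ⊥) →
             ∀ {L} → All P L → Unique L → sumℚ (map f L) ≤ 1ℚ
  sumℚ-≤-1 one []        []          = ≤ᵇ⇒≤ tt
  sumℚ-≤-1 one {y ∷ L} (Py ∷ PL) (y∉L ∷ uL) with f y ≟ 0ℚ
  ... | yes fy≡0 = sumℚ-≤-head y L fy≡0 (sumℚ-≤-1 one PL uL)
  ... | no fy≢0  = begin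
    f y + sumℚ (map f L)  ≡⟨ cong (_+_ (f y)) tail≡0 ⟩
    f y + 0ℚ              ≡⟨ +-identityʳ (f y) ⟩
    f y                   ≤⟨ proj₂ (f-bounded y) ⟩
    1ℚ                    ∎
    where
    tail≡0 : sumℚ (map f L) ≡ 0ℚ
    tail≡0 with sumℚ (map f L) ≟ 0ℚ
    ... | yes S≡0 = S≡0
    ... | no S≢0  with All.lookupAny (All.zip (PL , y∉L)) (sumℚ-≢0⇒Any L S≢0)
    ...   | (Pr , y≢r) , fr≢0 = ⊥-elim (one Py Pr y≢r fy≢0 fr≢0)

  sumℚ-≤-2 : (∀ {p q r} → p ≢ q → p ≢ r → q ≢ r → f p ≢ 0ℚ → f q ≢ 0ℚ → f r ≢ 0ℚ → ⊥) →
             ∀ {L} → Unique L → sumℚ (map f L) ≤ + 2 / 1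
  sumℚ-≤-2 two []          = ≤ᵇ⇒≤ tt
  sumℚ-≤-2 two {y ∷ L} (y∉L ∷ uL) with f y ≟ 0ℚ
  ... | yes fy≡0 = sumℚ-≤-head y L fy≡0 (sumℚ-≤-2 two uL)
  ... | no fy≢0  = +-mono-≤ (proj₂ (f-bounded y))
                     (sumℚ-≤-1 (λ y≢q y≢r q≢r → two y≢q y≢r q≢r fy≢0) y∉L uL)

Separated : List ℚ → Set
Separated = AllPairs (λ p q → p + 1ℚ ≤ q)

separated⇒unique : ∀ {L} → Separated L → Unique L
separated⇒unique = AllPairs.map (λ {p} p+1≤q → <⇒≢ (<-≤-trans (p<p+1 p) p+1≤q))
  where
  p<p+1 : ∀ p → p < p + 1ℚ
  p<p+1 p = subst (_< p + 1ℚ) (+-identityʳ p) (+-monoʳ-< p (positive⁻¹ 1ℚ))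

module _ {g : ℚ → ℚ} {c : ℚ} (g-bounded : ∀ y → g y ∈[0, c ]) where

  sumℚ-≤-diameter : ∀ {L} → Separated L →
    sumℚ (map g L) ≡ 0ℚ ⊎
    ∃₂ λ u v → u ∈ L × g u ≢ 0ℚ × g v ≢ 0ℚ × sumℚ (map g L) ≤ c * (v - u + 1ℚ)
  sumℚ-≤-diameter [] = inj₁ refl
  sumℚ-≤-diameter {y ∷ L} (y+1≤L ∷ sepL) with g y ≟ 0ℚ | sumℚ-≤-diameter sepL
  ... | yes gy≡0 | inj₁ S≡0 = inj₁ (cong₂ _+_ gy≡0 S≡0)
  ... | yes gy≡0 | inj₂ (u , v , u∈L , gu≢0 , gv≢0 , S≤) =
    inj₂ (u , v , there u∈L , gu≢0 , gv≢0 , sumℚ-≤-head y L gy≡0 S≤)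
  ... | no gy≢0  | inj₁ S≡0 = inj₂ (y , y , here refl , gy≢0 , gy≢0 , (begin
    g y + sumℚ (map g L)  ≡⟨ cong (_+_ (g y)) S≡0 ⟩
    g y + 0ℚ              ≡⟨ +-identityʳ (g y) ⟩
    g y                   ≤⟨ proj₂ (g-bounded y) ⟩
    c                     ≡⟨ solve 2 (λ c y → c := c :* (y :- y :+ con 1ℚ)) refl c y ⟩
    c * (y - y + 1ℚ)      ∎))
  ... | no gy≢0  | inj₂ (u , v , u∈L , _ , gv≢0 , S≤) = inj₂ (y , v , here refl , gy≢0 , gv≢0 , (begin
    g y + sumℚ (map g L)
      ≤⟨ +-mono-≤ (proj₂ (g-bounded y)) S≤ ⟩
    c + c * (v - u + 1ℚ)
      ≤⟨ p≤p+q (*-nonNeg 0≤c (p≤q⇒0≤q-p (All.lookup y+1≤L u∈L))) ⟩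
    c + c * (v - u + 1ℚ) + c * (u - (y + 1ℚ))
      ≡⟨ solve 4 (λ c u v y → c :+ c :* (v :- u :+ con 1ℚ) :+ c :* (u :- (y :+ con 1ℚ))
                             := c :* (v :- y :+ con 1ℚ)) refl c u v y ⟩
    c * (v - y + 1ℚ)
      ∎))
    where
    0≤c : 0ℚ ≤ c
    0≤c = ≤-trans (proj₁ (g-bounded y)) (proj₂ (g-bounded y))

diameter-square-≤ : ∀ {u v X} → u * u ≤ X → v * v ≤ X →
                    (v - u + 1ℚ) * (v - u + 1ℚ) ≤ (+ 8 / 1) * X + + 2 / 1
diameter-square-≤ {u} {v} {X} uu≤X vv≤X = begin
  (v - u + 1ℚ) * (v - u + 1ℚ)
    ≤⟨ p≤p+q (+-mono-≤ (+-mono-≤ (+-mono-≤ (square-nonNeg (v - u - 1ℚ))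
         (*-nonNeg (nonNegative⁻¹ (+ 2 / 1)) (square-nonNeg (u + v))))
         (*-nonNeg (nonNegative⁻¹ (+ 4 / 1)) (p≤q⇒0≤q-p uu≤X)))
         (*-nonNeg (nonNegative⁻¹ (+ 4 / 1)) (p≤q⇒0≤q-p vv≤X))) ⟩
  (v - u + 1ℚ) * (v - u + 1ℚ)
    + ((v - u - 1ℚ) * (v - u - 1ℚ) + (+ 2 / 1) * ((u + v) * (u + v))
       + (+ 4 / 1) * (X - u * u) + (+ 4 / 1) * (X - v * v))
    ≡⟨ solve 3 (λ u v X →
         (v :- u :+ con 1ℚ) :* (v :- u :+ con 1ℚ)
           :+ ((v :- u :- con 1ℚ) :* (v :- u :- con 1ℚ) :+ con (+ 2 / 1) :* ((u :+ v) :* (u :+ v))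
               :+ con (+ 4 / 1) :* (X :- u :* u) :+ con (+ 4 / 1) :* (X :- v :* v))
         := con (+ 8 / 1) :* X :+ con (+ 2 / 1)) refl u v X ⟩
  (+ 8 / 1) * X + + 2 / 1
    ∎

sumℚ-square-≤-diameter : ∀ {g c X} → (∀ y → g y ∈[0, c ]) → (∀ y → g y ≢ 0ℚ → y * y ≤ X) →
  0ℚ ≤ X → ∀ {L} → Separated L →
  sumℚ (map g L) * sumℚ (map g L) ≤ (c * c) * ((+ 8 / 1) * X + + 2 / 1)
sumℚ-square-≤-diameter {g} {c} {X} g-bounded support 0≤X {L} sepL
  with sumℚ-≤-diameter g-bounded sepL
... | inj₁ S≡0 rewrite S≡0 = *-nonNeg (square-nonNeg c)
        (+-mono-≤ (*-nonNeg (nonNegative⁻¹ (+ 8 / 1)) 0≤X) (nonNegative⁻¹ (+ 2 / 1)))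
... | inj₂ (u , v , _ , gu≢0 , gv≢0 , S≤) = begin
  sumℚ (map g L) * sumℚ (map g L)
    ≤⟨ square-mono-≤ (sumℚ-nonNeg (proj₁ ∘ g-bounded) L) S≤ ⟩
  (c * (v - u + 1ℚ)) * (c * (v - u + 1ℚ))
    ≡⟨ solve 3 (λ c u v → (c :* (v :- u :+ con 1ℚ)) :* (c :* (v :- u :+ con 1ℚ))
                        := (c :* c) :* ((v :- u :+ con 1ℚ) :* (v :- u :+ con 1ℚ))) refl c u v ⟩
  (c * c) * ((v - u + 1ℚ) * (v - u + 1ℚ))
    ≤⟨ *-monoˡ-≤-nonNeg (c * c) ⦃ nonNegative (square-nonNeg c) ⦄
         (diameter-square-≤ {u} {v} (support u gu≢0) (support v gv≢0)) ⟩
  (c * c) * ((+ 8 / 1) * X + + 2 / 1)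
    ∎

square-+-≤ : ∀ {p s k Y} → 0ℚ ≤ k → p * p ≤ Y → s * s ≤ (k * k) * Y →
             (p + s) * (p + s) ≤ ((1ℚ + k) * (1ℚ + k)) * Y
square-+-≤ {p} {s} {k} {Y} 0≤k pp≤Y ss≤kkY = begin
  (p + s) * (p + s)
    ≡⟨ solve 2 (λ p s → (p :+ s) :* (p :+ s) := p :* p :+ con (+ 2 / 1) :* (p :* s) :+ s :* s)
             refl p s ⟩
  p * p + (+ 2 / 1) * (p * s) + s * s
    ≤⟨ +-mono-≤ (+-mono-≤ pp≤Y (*-monoˡ-≤-nonNeg (+ 2 / 1) ps≤kY)) ss≤kkY ⟩
  Y + (+ 2 / 1) * (k * Y) + (k * k) * Y
    ≡⟨ solve 2 (λ k Y → Y :+ con (+ 2 / 1) :* (k :* Y) :+ (k :* k) :* Y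
                      := ((con 1ℚ :+ k) :* (con 1ℚ :+ k)) :* Y) refl k Y ⟩
  ((1ℚ + k) * (1ℚ + k)) * Y
    ∎
  where
  ps≤kY : p * s ≤ k * Y
  ps≤kY = square-cancel-≤ (*-nonNeg 0≤k (≤-trans (square-nonNeg p) pp≤Y)) (begin
    (p * s) * (p * s)  ≡⟨ solve 2 (λ p s → (p :* s) :* (p :* s) := (p :* p) :* (s :* s)) refl p s ⟩
    (p * p) * (s * s)  ≤⟨ *-mono-≤-nonNeg (square-nonNeg p) pp≤Y (square-nonNeg s) ss≤kkY ⟩
    Y * ((k * k) * Y)  ≡⟨ solve 2 (λ k Y → Y :* ((k :* k) :* Y) := (k :* Y) :* (k :* Y)) refl k Y ⟩
    (k * Y) * (k * Y)  ∎)

sumℚ-square-≤-length : ∀ {A : Set} {f : A → ℚ} {Y} → (∀ y → f y * f y ≤ Y) → ∀ L →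
  sumℚ (map f L) * sumℚ (map f L) ≤ ((+ length L / 1) * (+ length L / 1)) * Y
sumℚ-square-≤-length {Y = Y} f²≤Y [] = ≤-reflexive (sym (*-zeroˡ Y))
sumℚ-square-≤-length {f = f} {Y} f²≤Y (y ∷ L) =
  subst (λ t → sumℚ (map f (y ∷ L)) * sumℚ (map f (y ∷ L)) ≤ (t * t) * Y)
        (sym (/1-+ (+ 1) (+ length L)))
        (square-+-≤ {f y} {sumℚ (map f L)} (/1-nonNeg (length L)) (f²≤Y y)
                    (sumℚ-square-≤-length f²≤Y L))

-- Signs and weights

sgn-neg : ∀ {p} → p < 0ℚ → sgn p ≡ - 1ℚ
sgn-neg {p} p<0 rewrite dec-true (p <? 0ℚ) p<0 = refl

sgn-pos : ∀ {p} → 0ℚ < p → sgn p ≡ 1ℚ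
sgn-pos {p} 0<p rewrite dec-false (p <? 0ℚ) (<-asym 0<p) | dec-false (p ≟ 0ℚ) (≢-sym (<⇒≢ 0<p)) =
  refl

sgn-* : ∀ p q → sgn (p * q) ≡ sgn p * sgn q
sgn-* p q with <-cmp p 0ℚ | <-cmp q 0ℚ
... | tri≈ _ refl _ | _ = trans (cong sgn (*-zeroˡ q)) (sym (*-zeroˡ (sgn q)))
... | _ | tri≈ _ refl _ = trans (cong sgn (*-zeroʳ p)) (sym (*-zeroʳ (sgn p)))
... | tri< p<0 _ _ | tri< q<0 _ _ =
  trans (sgn-pos (positive⁻¹ (p * q) ⦃ neg*neg⇒pos p ⦃ negative p<0 ⦄ q ⦃ negative q<0 ⦄ ⦄))
        (sym (cong₂ _*_ (sgn-neg p<0) (sgn-neg q<0)))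
... | tri< p<0 _ _ | tri> _ _ 0<q =
  trans (sgn-neg (negative⁻¹ (p * q) ⦃ neg*pos⇒neg p ⦃ negative p<0 ⦄ q ⦃ positive 0<q ⦄ ⦄))
        (sym (cong₂ _*_ (sgn-neg p<0) (sgn-pos 0<q)))
... | tri> _ _ 0<p | tri< q<0 _ _ =
  trans (sgn-neg (negative⁻¹ (p * q) ⦃ pos*neg⇒neg p ⦃ positive 0<p ⦄ q ⦃ negative q<0 ⦄ ⦄))
        (sym (cong₂ _*_ (sgn-pos 0<p) (sgn-neg q<0)))
... | tri> _ _ 0<p | tri> _ _ 0<q =
  trans (sgn-pos (positive⁻¹ (p * q) ⦃ pos*pos⇒pos p ⦃ positive 0<p ⦄ q ⦃ positive 0<q ⦄ ⦄))
        (sym (cong₂ _*_ (sgn-pos 0<p) (sgn-pos 0<q)))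

θ⁺ θ⁻ : ℚ → ℚ
θ⁺ t = ½ * (1ℚ + sgn t)
θ⁻ t = ½ * (1ℚ - sgn t)

θ⁺-bounded : ∀ t → θ⁺ t ∈[0, 1ℚ ]
θ⁺-bounded t with <-cmp t 0ℚ
... | tri< t<0 _ _ rewrite sgn-neg t<0 = ≤-refl , ≤ᵇ⇒≤ tt
... | tri≈ _ refl _ = ≤ᵇ⇒≤ tt , ≤ᵇ⇒≤ tt
... | tri> _ _ 0<t rewrite sgn-pos 0<t = ≤ᵇ⇒≤ tt , ≤-refl

θ⁻-bounded : ∀ t → θ⁻ t ∈[0, 1ℚ ]
θ⁻-bounded t with <-cmp t 0ℚ
... | tri< t<0 _ _ rewrite sgn-neg t<0 = ≤ᵇ⇒≤ tt , ≤-refl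
... | tri≈ _ refl _ = ≤ᵇ⇒≤ tt , ≤ᵇ⇒≤ tt
... | tri> _ _ 0<t rewrite sgn-pos 0<t = ≤-refl , ≤ᵇ⇒≤ tt

θ⁺-support : ∀ {t} → θ⁺ t ≢ 0ℚ → 0ℚ ≤ t
θ⁺-support θ≢0 = ≮⇒≥ (λ t<0 → θ≢0 (cong (λ s → ½ * (1ℚ + s)) (sgn-neg t<0)))

θ⁻-support : ∀ {t} → θ⁻ t ≢ 0ℚ → t ≤ 0ℚ
θ⁻-support θ≢0 = ≮⇒≥ (λ 0<t → θ≢0 (cong (λ s → ½ * (1ℚ - s)) (sgn-pos 0<t)))

weight-pos : ∀ {n} x y → 0ℚ < n →
             weight n (x , y) ≡ θ⁺ (((+ 2 / 1) * x + y) * ((+ 2 / 1) * x - y))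
weight-pos {n} x y 0<n rewrite dec-true (0ℚ <? n) 0<n =
  cong (λ s → ½ * (1ℚ + s)) (sym (sgn-* ((+ 2 / 1) * x + y) ((+ 2 / 1) * x - y)))

weight-neg : ∀ {n} x y → n < 0ℚ →
             weight n (x , y) ≡ θ⁻ (((+ 3 / 1) * x + y) * ((+ 3 / 1) * x - y))
weight-neg {n} x y n<0 rewrite dec-false (0ℚ <? n) (<-asym n<0) | dec-true (n <? 0ℚ) n<0 =
  cong (λ s → ½ * (1ℚ - s)) (sym (sgn-* ((+ 3 / 1) * x + y) ((+ 3 / 1) * x - y)))

weight-bounded : ∀ n m → weight n m ∈[0, 1ℚ ]
weight-bounded n (x , y) with <-cmp 0ℚ n
... | tri< 0<n _ _ = subst (_∈[0, 1ℚ ]) (sym (weight-pos x y 0<n))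
                       (θ⁺-bounded (((+ 2 / 1) * x + y) * ((+ 2 / 1) * x - y)))
... | tri≈ _ refl _ = ≤-refl , ≤ᵇ⇒≤ tt
... | tri> _ _ n<0 = subst (_∈[0, 1ℚ ]) (sym (weight-neg x y n<0))
                       (θ⁻-bounded (((+ 3 / 1) * x + y) * ((+ 3 / 1) * x - y)))

square-≤-Q : ∀ x y → 0ℚ ≤ ((+ 2 / 1) * x + y) * ((+ 2 / 1) * x - y) → x * x ≤ Q (x , y)
square-≤-Q x y 0≤uv = begin
  x * x
    ≤⟨ p≤p+q (+-mono-≤ (*-nonNeg (nonNegative⁻¹ (+ 3 / 1)) (square-nonNeg x))
                       (*-nonNeg (nonNegative⁻¹ (+ 2 / 1)) 0≤uv)) ⟩
  x * x + ((+ 3 / 1) * (x * x) + (+ 2 / 1) * (((+ 2 / 1) * x + y) * ((+ 2 / 1) * x - y)))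
    ≡⟨ solve 2 (λ x y →
         x :* x :+ (con (+ 3 / 1) :* (x :* x)
                    :+ con (+ 2 / 1) :* ((con (+ 2 / 1) :* x :+ y) :* (con (+ 2 / 1) :* x :- y)))
         := con (+ 12 / 1) :* (x :* x) :- con (+ 2 / 1) :* (y :* y)) refl x y ⟩
  (+ 12 / 1) * (x * x) - (+ 2 / 1) * (y * y)
    ∎

square-≤-neg-Q : ∀ x y → ((+ 3 / 1) * x + y) * ((+ 3 / 1) * x - y) ≤ 0ℚ → x * x ≤ - Q (x , y)
square-≤-neg-Q x y uv≤0 = begin
  x * x
    ≤⟨ p≤p+q (+-mono-≤ (*-nonNeg (nonNegative⁻¹ (+ 5 / 1)) (square-nonNeg x))
                       (*-nonNeg (nonNegative⁻¹ (+ 2 / 1)) (neg-antimono-≤ uv≤0))) ⟩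
  x * x + ((+ 5 / 1) * (x * x) + (+ 2 / 1) * (- (((+ 3 / 1) * x + y) * ((+ 3 / 1) * x - y))))
    ≡⟨ solve 2 (λ x y →
         x :* x :+ (con (+ 5 / 1) :* (x :* x)
                    :+ con (+ 2 / 1) :* (:- ((con (+ 3 / 1) :* x :+ y) :* (con (+ 3 / 1) :* x :- y))))
         := :- (con (+ 12 / 1) :* (x :* x) :- con (+ 2 / 1) :* (y :* y))) refl x y ⟩
  - ((+ 12 / 1) * (x * x) - (+ 2 / 1) * (y * y))
    ∎

weight-support : ∀ n x y → weight n (x , y) ≢ 0ℚ → Q (x , y) ≡ n → x * x ≤ ∣ n ∣
weight-support n x y w≢0 Q≡n with <-cmp 0ℚ n
... | tri< 0<n _ _ = begin
  x * x      ≤⟨ square-≤-Q x y (θ⁺-support (w≢0 ∘ trans (weight-pos x y 0<n))) ⟩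
  Q (x , y)  ≡⟨ Q≡n ⟩
  n          ≡⟨ sym (0≤p⇒∣p∣≡p (<⇒≤ 0<n)) ⟩
  ∣ n ∣      ∎
... | tri≈ _ refl _ = ⊥-elim (w≢0 refl)
... | tri> _ _ n<0 = begin
  x * x        ≤⟨ square-≤-neg-Q x y (θ⁻-support (w≢0 ∘ trans (weight-neg x y n<0))) ⟩
  - Q (x , y)  ≡⟨ cong -_ Q≡n ⟩
  - n          ≡⟨ sym (p≤0⇒∣p∣≡-p (<⇒≤ n<0)) ⟩
  ∣ n ∣        ∎

-- The lattice sums a_μ(n)

latticeTerm : ℚ → ℚ × ℚ → ℚ
latticeTerm n m = if does (Q m ≟ n) then weight n m else 0ℚ

latticeTerm-bounded : ∀ n m → latticeTerm n m ∈[0, 1ℚ ]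
latticeTerm-bounded n m with Q m ≟ n
... | yes _ = weight-bounded n m
... | no _  = ≤-refl , ≤ᵇ⇒≤ tt

latticeTerm-support : ∀ n m → latticeTerm n m ≢ 0ℚ → weight n m ≢ 0ℚ × Q m ≡ n
latticeTerm-support n m t≢0 with Q m ≟ n
... | yes Q≡n = t≢0 , Q≡n
... | no _    = ⊥-elim (t≢0 refl)

Q-≡⇒square-≡ : ∀ x p q → Q (x , p) ≡ Q (x , q) → p * p ≡ q * q
Q-≡⇒square-≡ x p q Qp≡Qq = begin-equality
  p * p
    ≡⟨ solve 2 (λ x p → p :* p
                      := con (+ 6 / 1) :* (x :* x)
                         :- con ½ :* (con (+ 12 / 1) :* (x :* x) :- con (+ 2 / 1) :* (p :* p)))
             refl x p ⟩
  (+ 6 / 1) * (x * x) - ½ * ((+ 12 / 1) * (x * x) - (+ 2 / 1) * (p * p))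
    ≡⟨ cong (λ t → (+ 6 / 1) * (x * x) - ½ * t) Qp≡Qq ⟩
  (+ 6 / 1) * (x * x) - ½ * ((+ 12 / 1) * (x * x) - (+ 2 / 1) * (q * q))
    ≡⟨ solve 2 (λ x q → con (+ 6 / 1) :* (x :* x)
                         :- con ½ :* (con (+ 12 / 1) :* (x :* x) :- con (+ 2 / 1) :* (q :* q))
                      := q :* q)
             refl x q ⟩
  q * q
    ∎

shifted : ℚ → ℕ → List ℚ
shifted μ B = map (λ k → k / 1 + μ) (range B)

shifted-separated : ∀ μ B → Separated (shifted μ B)
shifted-separated μ B =
  AllPairsₚ.map⁺ (AllPairsₚ.map⁺ (AllPairs.map step (AllPairsₚ.applyUpTo⁺₁ _ _ (λ i<j _ → i<j))))
  where
  translate : ∀ p q → p + 1ℚ ≤ q → (p + μ) + 1ℚ ≤ q + μ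
  translate p q p+1≤q = begin
    (p + μ) + 1ℚ  ≡⟨ solve 2 (λ p μ → (p :+ μ) :+ con 1ℚ := (p :+ con 1ℚ) :+ μ) refl p μ ⟩
    (p + 1ℚ) + μ  ≤⟨ +-monoˡ-≤ μ p+1≤q ⟩
    q + μ         ∎
  step : ∀ {i j} → i ℕ.< j → ((+ i ℤ.- + B) / 1 + μ) + 1ℚ ≤ (+ j ℤ.- + B) / 1 + μ
  step {i} {j} i<j = translate ((+ i ℤ.- + B) / 1) ((+ j ℤ.- + B) / 1)
                               (/1-<⇒+1≤ (ℤP.+-monoˡ-< (ℤ.- + B) (+<+ i<j)))

columnSum : ℚ → ℚ → ℚ → ℚ
columnSum n μ₂ x = sumℚ (map (λ y → latticeTerm n (x , y)) (shifted μ₂ (bound n)))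

a-as-double-sum : ∀ μ₁ μ₂ n → a (μ₁ , μ₂) n ≡ sumℚ (map (columnSum n μ₂) (shifted μ₁ (bound n)))
a-as-double-sum μ₁ μ₂ n = begin-equality
  sumℚ (concat (map row R))                          ≡⟨ sumℚ-concat (map row R) ⟩
  sumℚ (map sumℚ (map row R))                        ≡⟨ cong sumℚ (sym (map-∘ R)) ⟩
  sumℚ (map (sumℚ ∘ row) R)                          ≡⟨ cong sumℚ (map-cong (λ k → cong sumℚ (map-∘ R)) R) ⟩
  sumℚ (map (λ k → columnSum n μ₂ (k / 1 + μ₁)) R)   ≡⟨ cong sumℚ (map-∘ R) ⟩
  sumℚ (map (columnSum n μ₂) (shifted μ₁ (bound n))) ∎
  where
  R : List ℤ
  R = range (bound n)
  row : ℤ → List ℚ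
  row k = map (λ l → latticeTerm n (k / 1 + μ₁ , l / 1 + μ₂)) R

columnSum-bounded : ∀ n μ₂ x → columnSum n μ₂ x ∈[0, + 2 / 1 ]
columnSum-bounded n μ₂ x =
  sumℚ-nonNeg (λ y → proj₁ (latticeTerm-bounded n (x , y))) (shifted μ₂ (bound n)) ,
  sumℚ-≤-2 (λ y → latticeTerm-bounded n (x , y)) no-three
           (separated⇒unique (shifted-separated μ₂ (bound n)))
  where
  root : ∀ {y} → latticeTerm n (x , y) ≢ 0ℚ → Q (x , y) ≡ n
  root {y} = proj₂ ∘ latticeTerm-support n (x , y)
  no-three : ∀ {p q r} → p ≢ q → p ≢ r → q ≢ r → latticeTerm n (x , p) ≢ 0ℚ →
             latticeTerm n (x , q) ≢ 0ℚ → latticeTerm n (x , r) ≢ 0ℚ → ⊥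
  no-three {p} {q} {r} p≢q p≢r q≢r tp≢0 tq≢0 tr≢0 = no-three-distinct-square-roots
    (Q-≡⇒square-≡ x p q (trans (root tp≢0) (sym (root tq≢0))))
    (Q-≡⇒square-≡ x p r (trans (root tp≢0) (sym (root tr≢0))))
    p≢q p≢r q≢r

columnSum-support : ∀ n μ₂ x → columnSum n μ₂ x ≢ 0ℚ → x * x ≤ ∣ n ∣
columnSum-support n μ₂ x c≢0 with Any.satisfied (sumℚ-≢0⇒Any (shifted μ₂ (bound n)) c≢0)
... | y , t≢0 = weight-support n x y (proj₁ support) (proj₂ support)
  where support = latticeTerm-support n (x , y) t≢0

a-bounded : ∀ μ n →
  0ℚ ≤ a μ n × a μ n * a μ n ≤ ((+ 2 / 1) * (+ 2 / 1)) * ((+ 8 / 1) * ∣ n ∣ + + 2 / 1)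
a-bounded (μ₁ , μ₂) n rewrite a-as-double-sum μ₁ μ₂ n =
  sumℚ-nonNeg (proj₁ ∘ columnSum-bounded n μ₂) (shifted μ₁ (bound n)) ,
  sumℚ-square-≤-diameter (columnSum-bounded n μ₂) (columnSum-support n μ₂) (0≤∣p∣ n)
                         (shifted-separated μ₁ (bound n))

-- The differences d_j(n)

half-difference-square-≤ : ∀ {p q A B} → 0ℚ ≤ p → 0ℚ ≤ q → p * p ≤ A → q * q ≤ B →
                           (½ * (p - q)) * (½ * (p - q)) ≤ (+ 1 / 4) * (A + B)
half-difference-square-≤ {p} {q} {A} {B} 0≤p 0≤q pp≤A qq≤B = begin
  (½ * (p - q)) * (½ * (p - q))
    ≡⟨ solve 2 (λ p q → (con ½ :* (p :- q)) :* (con ½ :* (p :- q))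
                      := con (+ 1 / 4) :* ((p :- q) :* (p :- q))) refl p q ⟩
  (+ 1 / 4) * ((p - q) * (p - q))  ≤⟨ *-monoˡ-≤-nonNeg (+ 1 / 4) (difference-square-≤ 0≤p 0≤q) ⟩
  (+ 1 / 4) * (p * p + q * q)      ≤⟨ *-monoˡ-≤-nonNeg (+ 1 / 4) (+-mono-≤ pp≤A qq≤B) ⟩
  (+ 1 / 4) * (A + B)              ∎

length-S± : ∀ j → length (S⁺ j) ≡ 4 × length (S⁻ j) ≡ 4
length-S± zero             = refl , refl
length-S± (suc zero)       = refl , refl
length-S± (suc (suc zero)) = refl , refl

d-square-≤ : ∀ {Y} j n → (∀ μ → 0ℚ ≤ a μ n × a μ n * a μ n ≤ Y) → d j n * d j n ≤ (+ 8 / 1) * Y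
d-square-≤ {Y} j n a-bounded = begin
  d j n * d j n
    ≤⟨ half-difference-square-≤ (sumℚ-nonNeg (proj₁ ∘ a-bounded) (S⁺ j))
                                (sumℚ-nonNeg (proj₁ ∘ a-bounded) (S⁻ j))
                                (sumℚ-square-≤-length (proj₂ ∘ a-bounded) (S⁺ j))
                                (sumℚ-square-≤-length (proj₂ ∘ a-bounded) (S⁻ j)) ⟩
  (+ 1 / 4) * (((+ length (S⁺ j) / 1) * (+ length (S⁺ j) / 1)) * Y
               + ((+ length (S⁻ j) / 1) * (+ length (S⁻ j) / 1)) * Y)
    ≡⟨ cong₂ (λ k l → (+ 1 / 4) * (((+ k / 1) * (+ k / 1)) * Y + ((+ l / 1) * (+ l / 1)) * Y))
             (proj₁ (length-S± j)) (proj₂ (length-S± j)) ⟩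
  (+ 1 / 4) * (((+ 4 / 1) * (+ 4 / 1)) * Y + ((+ 4 / 1) * (+ 4 / 1)) * Y)
    ≡⟨ solve 1 (λ Y → con (+ 1 / 4) :* ((con (+ 4 / 1) :* con (+ 4 / 1)) :* Y
                                        :+ (con (+ 4 / 1) :* con (+ 4 / 1)) :* Y)
                    := con (+ 8 / 1) :* Y) refl Y ⟩
  (+ 8 / 1) * Y
    ∎

distance-from-ℤ : ∀ {δ b} → δ ≤ b → b ≤ 1ℚ - δ → ∀ k → δ ≤ ∣ k / 1 + b ∣
distance-from-ℤ {δ} {b} δ≤b _ (+ m) = begin
  δ                ≤⟨ δ≤b ⟩
  b                ≡⟨ sym (+-identityˡ b) ⟩
  0ℚ + b           ≤⟨ +-monoˡ-≤ b (/1-nonNeg m) ⟩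
  + m / 1 + b      ≤⟨ p≤∣p∣ (+ m / 1 + b) ⟩
  ∣ + m / 1 + b ∣  ∎
distance-from-ℤ {δ} {b} _ b≤1-δ -[1+ m ] = begin
  δ                     ≡⟨ solve 1 (λ δ → δ := :- (:- con 1ℚ :+ (con 1ℚ :- δ))) refl δ ⟩
  - (- 1ℚ + (1ℚ - δ))   ≤⟨ neg-antimono-≤ (+-mono-≤ (/1-mono-≤ { -[1+ m ]} { -[1+ 0 ]} (-≤- z≤n)) b≤1-δ) ⟩
  - (-[1+ m ] / 1 + b)  ≤⟨ -p≤∣p∣ (-[1+ m ] / 1 + b) ⟩
  ∣ -[1+ m ] / 1 + b ∣  ∎

β-distance : ∀ j → + 1 / 48 ≤ β j × β j ≤ 1ℚ - + 1 / 48
β-distance zero             = ≤ᵇ⇒≤ tt , ≤ᵇ⇒≤ tt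
β-distance (suc zero)       = ≤ᵇ⇒≤ tt , ≤ᵇ⇒≤ tt
β-distance (suc (suc zero)) = ≤ᵇ⇒≤ tt , ≤ᵇ⇒≤ tt

-- 58² X − 8 · 4 · (8 X + 2) = 3108 X − 64 = 3108 (X − 1/48) + 3/4.
constant-≤ : ∀ {X} → + 1 / 48 ≤ X →
  (+ 8 / 1) * (((+ 2 / 1) * (+ 2 / 1)) * ((+ 8 / 1) * X + + 2 / 1)) ≤ ((+ 58 / 1) * (+ 58 / 1)) * X
constant-≤ {X} X≥1/48 = begin
  (+ 8 / 1) * (((+ 2 / 1) * (+ 2 / 1)) * ((+ 8 / 1) * X + + 2 / 1))
    ≤⟨ p≤p+q (+-mono-≤ (*-nonNeg (nonNegative⁻¹ (+ 3108 / 1)) (p≤q⇒0≤q-p X≥1/48))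
                       (nonNegative⁻¹ (+ 3 / 4))) ⟩
  (+ 8 / 1) * (((+ 2 / 1) * (+ 2 / 1)) * ((+ 8 / 1) * X + + 2 / 1))
    + ((+ 3108 / 1) * (X - + 1 / 48) + + 3 / 4)
    ≡⟨ solve 1 (λ X → con (+ 8 / 1) :* ((con (+ 2 / 1) :* con (+ 2 / 1)) :* (con (+ 8 / 1) :* X :+ con (+ 2 / 1)))
                      :+ (con (+ 3108 / 1) :* (X :- con (+ 1 / 48)) :+ con (+ 3 / 4))
                    := (con (+ 58 / 1) :* con (+ 58 / 1)) :* X) refl X ⟩
  ((+ 58 / 1) * (+ 58 / 1)) * X
    ∎

corollaryA3 : (j : Fin 3) → Σ ℚ λ C → ((k : ℤ) →
    ∣ d j ((k / 1) + β j) ∣ * ∣ d j ((k / 1) + β j) ∣ ≤ (C * C) * ∣ (k / 1) + β j ∣)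
corollaryA3 j = + 58 / 1 , λ k → let n = k / 1 + β j in begin
  ∣ d j n ∣ * ∣ d j n ∣  ≡⟨ sym (∣p*q∣≡∣p∣*∣q∣ (d j n) (d j n)) ⟩
  ∣ d j n * d j n ∣      ≡⟨ 0≤p⇒∣p∣≡p (square-nonNeg (d j n)) ⟩
  d j n * d j n          ≤⟨ d-square-≤ j n (λ μ → a-bounded μ n) ⟩
  (+ 8 / 1) * (((+ 2 / 1) * (+ 2 / 1)) * ((+ 8 / 1) * ∣ n ∣ + + 2 / 1))
    ≤⟨ constant-≤ (distance-from-ℤ (proj₁ (β-distance j)) (proj₂ (β-distance j)) k) ⟩
  ((+ 58 / 1) * (+ 58 / 1)) * ∣ n ∣
    ∎
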